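{- Let $T$ be a regular $s$-interval exchange transformation on $[\ell,r[$. If a semi-interval $I$ strictly included in $[\ell,r[$ is admissible for $T$, then $I\subset Y(T)$ or $I\subset Z(T)$.
   Context: Let $A$ be a finite alphabet of cardinality $s$ with two total orders $<_1,<_2$; write $A=\{a_1<_1\cdots<_1a_s\}$. A semi-interval is $[\alpha,\beta[=\{z:\alpha\le z<\beta\}$. An $s$-interval exchange transformation $T$ on $[\ell,r[$ is given by a partition $(I_a)_{a\in A}$ of $[\ell,r[$ into semi-intervals $I_a=[\gamma_a,\mu_a[$ of lengths $\lambda_a>0$ placed left to right in the order $<_1$; with $\nu_a=\ell+\sum_{b\le_2a}\lambda_b$, $T(z)=z+\nu_a-\mu_a$ on $I_a$, mapping $I_a$ onto $J_a=[\delta_a,\nu_a[$, $\delta_a=\nu_a-\lambda_a$. Write $\gamma_i=\gamma_{a_i}$; separation points $\gamma_1=\ell,\dots,\gamma_s$. $T$ is regular if the orbits $\{T^n(\gamma_i):n\in\mathbb Z\}$, $2\le i\le s$, are infinite and pairwise disjoint. Admissibility: for $I=[u,v[$ and $z\in[\ell,r[$ let $\rho^+_{I,T}(z)=\min\{n>0:T^n(z)\in\,]u,v[\}$, $\rho^-_{I,T}(z)=\min\{n\ge0:T^{ -n}(z)\in\,]u,v[\}$, $E_{I,T}(z)=\{k:-\rho^-_{I,T}(z)\le k<\rho^+_{I,T}(z)\}$, $N_{I,T}(z)=\{T^k(z):k\in E_{I,T}(z)\}$, $\mathrm{Div}(I,T)=\bigcup_{i=1}^sN_{I,T}(\gamma_i)$;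 $I=[u,v[$ with $\ell\le u<v\le r$ is admissible if $u,v\in\mathrm{Div}(I,T)\cup\{r\}$. With $b_{\max}$, $b_{\min}$ the $<_2$-largest and $<_2$-smallest letters, $Z(T)=[\ell,\max\{\gamma_{a_s},\delta_{b_{\max}}\}[$ and $Y(T)=[\min\{\mu_{a_1},\nu_{b_{\min}}\},r[$. -}

module Defs where

open import Level using (0ℓ)
open import Data.Nat as ℕ using (ℕ; zero; suc)
open import Data.Integer using (ℤ; +_; -[1+_])
open import Data.Fin using (Fin; toℕ; fromℕ)
open import Data.Fin.Permutation using (Permutation′; _⟨$⟩ʳ_; _⟨$⟩ˡ_)
open import Data.Bool using (Bool; true; false; if_then_else_; _∧_)
open import Data.List using (List; []; _∷_; foldr; allFin)
open import Data.List.Membership.Propositional using (_∈_)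
open import Data.Maybe using (Maybe; just; nothing)
open import Data.Product using (Σ; ∃; _×_; _,_)
open import Data.Sum using (_⊎_)
open import Data.Empty using (⊥)
open import Relation.Nullary using (¬_)
open import Relation.Binary.PropositionalEquality using (_≡_)
open import Relation.Binary.Definitions using (Trichotomous; tri<; tri≈; tri>)

-- An axiomatic model of the real numbers: a (Dedekind-)complete ordered
-- field, with the (classically valid) trichotomy of the order.
-- Every model is isomorphic to ℝ.

record RealField : Set₁ where
  infixl 6 _+_
  infixl 7 _*_
  infix  4 _<_
  field
    R    : Set
    0# 1# : R
    _+_ _*_ : R → R → R
    -_   : R → R
    _<_  : R → R → Set
    +-assoc     : ∀ x y z → (x + y) + z ≡ x + (y + z)
    +-comm      : ∀ x y → x + y ≡ y + x
    +-identityˡ : ∀ x → 0# + x ≡ x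
    +-inverseˡ  : ∀ x → (- x) + x ≡ 0#
    *-assoc     : ∀ x y z → (x * y) * z ≡ x * (y * z)
    *-comm      : ∀ x y → x * y ≡ y * x
    *-identityˡ : ∀ x → 1# * x ≡ x
    *-inverse   : ∀ x → ¬ (x ≡ 0#) → ∃ λ y → y * x ≡ 1#
    distribˡ    : ∀ x y z → x * (y + z) ≡ (x * y) + (x * z)
    0≢1         : ¬ (0# ≡ 1#)
    <-trans     : ∀ {x y z} → x < y → y < z → x < z
    <-tri       : Trichotomous _≡_ _<_
    +-mono-<    : ∀ {x y} z → x < y → x + z < y + z
    *-pos       : ∀ {x y} → 0# < x → 0# < y → 0# < x * y
    lub : (P : R → Set) → (∃ λ x → P x) →
          (∃ λ b → ∀ x → P x → (x < b ⊎ x ≡ b)) →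
          ∃ λ m → (∀ x → P x → (x < m ⊎ x ≡ m)) ×
                  (∀ b → (∀ x → P x → (x < b ⊎ x ≡ b)) → (m < b ⊎ m ≡ b))

module RealOps (F : RealField) where
  open RealField F public

  infix 4 _≤_
  _≤_ : R → R → Set
  x ≤ y = x < y ⊎ x ≡ y

  infixl 6 _-_
  _-_ : R → R → R
  x - y = x + (- y)

  _<ᵇ_ : R → R → Bool
  x <ᵇ y with <-tri x y
  ... | tri< _ _ _ = true
  ... | tri≈ _ _ _ = false
  ... | tri> _ _ _ = false

  _≤ᵇ_ : R → R → Bool
  x ≤ᵇ y with <-tri y x
  ... | tri< _ _ _ = false
  ... | tri≈ _ _ _ = true
  ... | tri> _ _ _ = true

  max min : R → R → R
  max x y = if x <ᵇ y then y else x
  min x y = if x <ᵇ y then x else y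

  sumFin : (n : ℕ) → (Fin n → R) → R
  sumFin n f = foldr (λ a acc → f a + acc) 0# (allFin n)

findFin : {n : ℕ} → (Fin n → Bool) → Maybe (Fin n)
findFin {zero}  p = nothing
findFin {suc n} p with p Fin.zero
... | true  = just Fin.zero
... | false with findFin {n} (λ i → p (Fin.suc i))
...   | just i  = just (Fin.suc i)
...   | nothing = nothing

-- The alphabet A = {a_1 <_1 ... <_1 a_s} is identified with Fin s
-- (index = position in the order <_1).  The order <_2 is given by a
-- permutation π : rank₂ a = π ⟨$⟩ʳ a is the position of a in <_2.
-- λ a are the lengths, ℓ the left endpoint.

module IET (F : RealField) (s : ℕ) (π : Permutation′ s) (len : Fin s → RealField.R F) (ℓ : RealField.R F) where
  open RealOps F

  rank₂ : Fin s → ℕ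
  rank₂ a = toℕ (π ⟨$⟩ʳ a)

  r : R
  r = ℓ + sumFin s len

  γ : Fin s → R
  γ a = ℓ + sumFin s (λ b → if toℕ b ℕ.<ᵇ toℕ a then len b else 0#)

  μ : Fin s → R
  μ a = γ a + len a

  ν : Fin s → R
  ν a = ℓ + sumFin s (λ b → if rank₂ b ℕ.≤ᵇ rank₂ a then len b else 0#)

  δ : Fin s → R
  δ a = ν a - len a

  T : R → R
  T z with findFin (λ a → (γ a ≤ᵇ z) ∧ (z <ᵇ μ a))
  ... | just a  = z + ν a - μ a
  ... | nothing = z

  T⁻¹ : R → R
  T⁻¹ z with findFin (λ a → (δ a ≤ᵇ z) ∧ (z <ᵇ ν a))
  ... | just a  = z + μ a - ν a
  ... | nothing = z

  Tⁿ : ℕ → R → R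
  Tⁿ zero    z = z
  Tⁿ (suc n) z = T (Tⁿ n z)

  T⁻ⁿ : ℕ → R → R
  T⁻ⁿ zero    z = z
  T⁻ⁿ (suc n) z = T⁻¹ (T⁻ⁿ n z)

  Tℤ : ℤ → R → R
  Tℤ (+ n)     z = Tⁿ n z
  Tℤ -[1+ n ] z = T⁻ⁿ (suc n) z

  Orbit : R → R → Set
  Orbit z x = ∃ λ (n : ℤ) → x ≡ Tℤ n z

  InfiniteSet : (R → Set) → Set
  InfiniteSet P = ¬ (∃ λ (xs : List R) → ∀ x → P x → x ∈ xs)

  -- separation points γ_2,…,γ_s  (0-based index ≥ 1)
  Regular : Set
  Regular =
    (∀ (i : Fin s) → 1 ℕ.≤ toℕ i → InfiniteSet (Orbit (γ i))) ×
    (∀ (i j : Fin s) → 1 ℕ.≤ toℕ i → 1 ℕ.≤ toℕ j → ¬ (i ≡ j) →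
       ∀ x → Orbit (γ i) x → Orbit (γ j) x → ⊥)

  InOpen : R → R → R → Set
  InOpen u v y = (u < y) × (y < v)

  -- x ∈ N_{I,T}(z) for I = [u,v[ :  x = T^k z with -ρ⁻(z) ≤ k < ρ⁺(z),
  -- where ρ⁺(z) = min{n>0 : T^n z ∈ ]u,v[}, ρ⁻(z) = min{n≥0 : T^{-n} z ∈ ]u,v[}.
  -- For k ≥ 0:  k < ρ⁺(z)  ⇔  T^n z ∉ ]u,v[ for all 0 < n ≤ k.
  -- For k = -m < 0:  m ≤ ρ⁻(z)  ⇔  T^{-n} z ∉ ]u,v[ for all 0 ≤ n < m.
  InN : R → R → R → R → Set
  InN u v z x =
    (∃ λ (k : ℕ) → (x ≡ Tⁿ k z) ×
        (∀ n → 1 ℕ.≤ n → n ℕ.≤ k → ¬ InOpen u v (Tⁿ n z)))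
    ⊎
    (∃ λ (m : ℕ) → (1 ℕ.≤ m) × (x ≡ T⁻ⁿ m z) ×
        (∀ n → n ℕ.< m → ¬ InOpen u v (T⁻ⁿ n z)))

  Div : R → R → R → Set
  Div u v x = ∃ λ (i : Fin s) → InN u v (γ i) x

  Admissible : R → R → Set
  Admissible u v =
    (ℓ ≤ u) × (u < v) × (v ≤ r) ×
    (Div u v u ⊎ u ≡ r) × (Div u v v ⊎ v ≡ r)

  SubInterval : R → R → R → R → Set
  SubInterval u v a b = ∀ z → u ≤ z → z < v → (a ≤ z) × (z < b)

-- Z(T) and Y(T); for these the alphabet is nonempty (s = suc n).
module IET₁ (F : RealField) (n : ℕ) (π : Permutation′ (suc n)) (len : Fin (suc n) → RealField.R F) (ℓ : RealField.R F) where
  open RealOps F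
  open IET F (suc n) π len ℓ public

  a₁ aₛ bmin bmax : Fin (suc n)
  a₁   = Fin.zero
  aₛ   = fromℕ n
  bmin = π ⟨$⟩ˡ Fin.zero
  bmax = π ⟨$⟩ˡ fromℕ n

  -- Z(T) = [ℓ, max{γ_{a_s}, δ_{b_max}}[
  Zright : R
  Zright = max (γ aₛ) (δ bmax)

  -- Y(T) = [min{μ_{a_1}, ν_{b_min}}, r[
  Yleft : R
  Yleft = min (μ a₁) (ν bmin)

-- If [u,v[ lies neither in Y(T) nor in Z(T), then
-- u < μ a₁, u < ν bmin, γ aₛ < v and δ bmax < v.  Every γ a and every T(γ a) = δ a
-- lies below v, so one of them outside ]u,v[ lies left of μ a₁ resp. ν bmin, which
-- forces it to be γ a₁ = ℓ resp. δ bmin = ℓ.  Hence the orbit pieces N_{I,T}(γ_i)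
-- never leave the separation points (forwards they stick at ℓ, backwards they pass
-- through T⁻¹ ℓ = γ bmin), so both endpoints of an admissible I are separation
-- points or r.  As u ∉ ]u,v[ this gives u = ℓ, and as γ a ≤ γ aₛ < v it gives v = r.
module Submission where

open import Defs
open import Function using (_∘_; id; Equivalence)
open import Data.Bool as Bool using (Bool; true; false; if_then_else_; _∧_)
open import Data.Bool.Properties using (T-∧)
open import Data.Empty using (⊥-elim)
open import Data.Fin using (Fin; zero; suc; toℕ; _≟_)
import Data.Fin.Properties as Finₚ
open import Data.Fin.Permutation using (Permutation′; _⟨$⟩ʳ_; _⟨$⟩ˡ_; inverseˡ; inverseʳ)
open import Data.List using (foldr; tabulate)
open import Data.Maybe using (just)
open import Data.Nat as ℕ using (ℕ; z≤n; s≤s)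
import Data.Nat.Properties as ℕₚ
open import Data.Product using (∃; _×_; _,_; proj₁; proj₂)
open import Data.Sum using (_⊎_; inj₁; inj₂)
open import Relation.Binary.Consequences using (tri⇒irr; tri⇒dec<)
open import Relation.Binary.Definitions using (Decidable; tri<; tri≈; tri>)
open import Relation.Binary.PropositionalEquality
open import Relation.Nullary using (¬_; yes; no)
import Relation.Binary.Construct.StrictToNonStrict as StrictToNonStrict

module OrderedField (F : RealField) where
  open RealOps F
  private
    module NonStrict = StrictToNonStrict _≡_ _<_

  <-irrefl : ∀ {x} → ¬ x < x
  <-irrefl = tri⇒irr <-tri refl

  _<?_ : Decidable _<_
  _<?_ = tri⇒dec< <-tri

  ≤-trans : ∀ {x y z} → x ≤ y → y ≤ z → x ≤ z
  ≤-trans = NonStrict.trans isEquivalence (resp₂ _<_) <-trans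

  <-≤-trans : ∀ {x y z} → x < y → y ≤ z → x < z
  <-≤-trans = NonStrict.<-≤-trans <-trans (proj₁ (resp₂ _<_))

  ≤-<-trans : ∀ {x y z} → x ≤ y → y < z → x < z
  ≤-<-trans = NonStrict.≤-<-trans sym <-trans (proj₂ (resp₂ _<_))

  ≮⇒≥ : ∀ {x y} → ¬ y < x → x ≤ y
  ≮⇒≥ {x} {y} y≮x with <-tri x y
  ... | tri< x<y _ _ = inj₁ x<y
  ... | tri≈ _ x≡y _ = inj₂ x≡y
  ... | tri> _ _ y<x = ⊥-elim (y≮x y<x)

  <ᵇ⇒< : ∀ {x y} → Bool.T (x <ᵇ y) → x < y
  <ᵇ⇒< {x} {y} p with <-tri x y
  ... | tri< x<y _ _ = x<y

  <⇒<ᵇ : ∀ {x y} → x < y → Bool.T (x <ᵇ y)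
  <⇒<ᵇ {x} {y} x<y with <-tri x y
  ... | tri< _ _ _ = _
  ... | tri≈ x≮y _ _ = x≮y x<y
  ... | tri> x≮y _ _ = x≮y x<y

  ≤ᵇ⇒≤ : ∀ {x y} → Bool.T (x ≤ᵇ y) → x ≤ y
  ≤ᵇ⇒≤ {x} {y} p with <-tri y x
  ... | tri≈ _ y≡x _ = inj₂ (sym y≡x)
  ... | tri> _ _ x<y = inj₁ x<y

  ≤⇒≤ᵇ : ∀ {x y} → x ≤ y → Bool.T (x ≤ᵇ y)
  ≤⇒≤ᵇ {x} {y} x≤y with <-tri y x
  ... | tri< y<x _ _ = <-irrefl (≤-<-trans x≤y y<x)
  ... | tri≈ _ _ _ = _
  ... | tri> _ _ _ = _

  min≤ˡ : ∀ x y → min x y ≤ x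
  min≤ˡ x y with <-tri x y
  ... | tri< _ _ _ = inj₂ refl
  ... | tri≈ _ x≡y _ = inj₂ (sym x≡y)
  ... | tri> _ _ y<x = inj₁ y<x

  min≤ʳ : ∀ x y → min x y ≤ y
  min≤ʳ x y with <-tri x y
  ... | tri< x<y _ _ = inj₁ x<y
  ... | tri≈ _ _ _ = inj₂ refl
  ... | tri> _ _ _ = inj₂ refl

  ≤maxˡ : ∀ x y → x ≤ max x y
  ≤maxˡ x y with <-tri x y
  ... | tri< x<y _ _ = inj₁ x<y
  ... | tri≈ _ _ _ = inj₂ refl
  ... | tri> _ _ _ = inj₂ refl

  ≤maxʳ : ∀ x y → y ≤ max x y
  ≤maxʳ x y with <-tri x y
  ... | tri< _ _ _ = inj₂ refl
  ... | tri≈ _ x≡y _ = inj₂ (sym x≡y)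
  ... | tri> _ _ y<x = inj₁ y<x

  _∈[_,_[ : R → R → R → Set
  x ∈[ a , b [ = a ≤ x × x < b

  ∈[,[ᵇ⇒∈[,[ : ∀ {x a b} → Bool.T ((a ≤ᵇ x) ∧ (x <ᵇ b)) → x ∈[ a , b [
  ∈[,[ᵇ⇒∈[,[ p with Equivalence.to T-∧ p
  ... | a≤x , x<b = ≤ᵇ⇒≤ a≤x , <ᵇ⇒< x<b

  ∈[,[⇒∈[,[ᵇ : ∀ {x a b} → x ∈[ a , b [ → Bool.T ((a ≤ᵇ x) ∧ (x <ᵇ b))
  ∈[,[⇒∈[,[ᵇ (a≤x , x<b) = Equivalence.from T-∧ (≤⇒≤ᵇ a≤x , <⇒<ᵇ x<b)

  ordered-intervals-disjoint : ∀ {A : Set} (key : A → ℕ) (lo hi : A → R) →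
    (∀ {a b} → key b ℕ.< key a → hi b ≤ lo a) →
    ∀ {a b x} → x ∈[ lo a , hi a [ → x ∈[ lo b , hi b [ → key a ≡ key b
  ordered-intervals-disjoint key lo hi separated {a} {b} (lo[a]≤x , x<hi[a]) (lo[b]≤x , x<hi[b])
    with ℕₚ.<-cmp (key a) (key b)
  ... | tri< ka<kb _ _ = ⊥-elim (<-irrefl (<-≤-trans x<hi[a] (≤-trans (separated ka<kb) lo[b]≤x)))
  ... | tri≈ _ ka≡kb _ = ka≡kb
  ... | tri> _ _ kb<ka = ⊥-elim (<-irrefl (<-≤-trans x<hi[b] (≤-trans (separated kb<ka) lo[a]≤x)))

  +-identityʳ : ∀ x → x + 0# ≡ x
  +-identityʳ x = trans (+-comm x 0#) (+-identityˡ x)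

  x+y-y≡x : ∀ x y → x + y - y ≡ x
  x+y-y≡x x y = begin
    x + y + - y   ≡⟨ +-assoc x y (- y) ⟩
    x + (y + - y) ≡⟨ cong (x +_) (trans (+-comm y (- y)) (+-inverseˡ y)) ⟩
    x + 0#        ≡⟨ +-identityʳ x ⟩
    x             ∎
    where open ≡-Reasoning

  x-y+y≡x : ∀ x y → x - y + y ≡ x
  x-y+y≡x x y = begin
    x + - y + y   ≡⟨ +-assoc x (- y) y ⟩
    x + (- y + y) ≡⟨ cong (x +_) (+-inverseˡ y) ⟩
    x + 0#        ≡⟨ +-identityʳ x ⟩
    x             ∎
    where open ≡-Reasoning

  x+[y+z]≡y+[x+z] : ∀ x y z → x + (y + z) ≡ y + (x + z)
  x+[y+z]≡y+[x+z] x y z = begin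
    x + (y + z) ≡⟨ sym (+-assoc x y z) ⟩
    x + y + z   ≡⟨ cong (_+ z) (+-comm x y) ⟩
    y + x + z   ≡⟨ +-assoc y x z ⟩
    y + (x + z) ∎
    where open ≡-Reasoning

  x+[y+z]-[x+z]≡y : ∀ x y z → x + (y + z) - (x + z) ≡ y
  x+[y+z]-[x+z]≡y x y z =
    trans (cong (_- (x + z)) (x+[y+z]≡y+[x+z] x y z)) (x+y-y≡x y (x + z))

  +-monoʳ-< : ∀ {x y} z → x < y → z + x < z + y
  +-monoʳ-< {x} {y} z x<y = subst₂ _<_ (+-comm x z) (+-comm y z) (+-mono-< z x<y)

  +-monoʳ-≤ : ∀ {x y} z → x ≤ y → z + x ≤ z + y
  +-monoʳ-≤ z (inj₁ x<y) = inj₁ (+-monoʳ-< z x<y)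
  +-monoʳ-≤ z (inj₂ refl) = inj₂ refl

  +-monoˡ-≤ : ∀ {x y} z → x ≤ y → x + z ≤ y + z
  +-monoˡ-≤ z (inj₁ x<y) = inj₁ (+-mono-< z x<y)
  +-monoˡ-≤ z (inj₂ refl) = inj₂ refl

  +-mono-≤ : ∀ {x y z w} → x ≤ y → z ≤ w → x + z ≤ y + w
  +-mono-≤ {y = y} {z} x≤y z≤w = ≤-trans (+-monoˡ-≤ z x≤y) (+-monoʳ-≤ y z≤w)

  x<x+y : ∀ x {y} → 0# < y → x < x + y
  x<x+y x {y} 0<y = subst₂ _<_ (+-identityˡ x) (+-comm y x) (+-mono-< x 0<y)

  sum : (m : ℕ) → (Fin m → R) → R
  sum ℕ.zero    f = 0#
  sum (ℕ.suc m) f = f zero + sum m (f ∘ suc)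

  sumFin≡sum : ∀ m f → sumFin m f ≡ sum m f
  sumFin≡sum m f = foldr-tabulate m id
    where
    foldr-tabulate : ∀ {A : Set} m (g : Fin m → A) {h : A → R} →
      foldr (λ a acc → h a + acc) 0# (tabulate g) ≡ sum m (h ∘ g)
    foldr-tabulate ℕ.zero    g = refl
    foldr-tabulate (ℕ.suc m) g {h} = cong (h (g zero) +_) (foldr-tabulate m (g ∘ suc))

  sum-cong : ∀ {m} {f g : Fin m → R} → (∀ i → f i ≡ g i) → sum m f ≡ sum m g
  sum-cong {ℕ.zero}  f≗g = refl
  sum-cong {ℕ.suc m} f≗g = cong₂ _+_ (f≗g zero) (sum-cong (f≗g ∘ suc))

  sum-mono : ∀ {m} {f g : Fin m → R} → (∀ i → f i ≤ g i) → sum m f ≤ sum m g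
  sum-mono {ℕ.zero}  f≤g = inj₂ refl
  sum-mono {ℕ.suc m} f≤g = +-mono-≤ (f≤g zero) (sum-mono (f≤g ∘ suc))

  sum-zero : ∀ {m} {f : Fin m → R} → (∀ i → f i ≡ 0#) → sum m f ≡ 0#
  sum-zero {ℕ.zero}  f≗0 = refl
  sum-zero {ℕ.suc m} f≗0 = trans (cong₂ _+_ (f≗0 zero) (sum-zero (f≗0 ∘ suc))) (+-identityˡ 0#)

  sum-extract : ∀ {m} {f g : Fin m → R} {d} (c : Fin m) →
    (∀ i → i ≢ c → f i ≡ g i) → f c ≡ g c + d → sum m f ≡ sum m g + d
  sum-extract {ℕ.suc m} {f} {g} {d} zero f≗g f[c]≡ = begin
    f zero + sum m (f ∘ suc)    ≡⟨ cong₂ _+_ f[c]≡ (sum-cong (λ i → f≗g (suc i) λ ())) ⟩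
    g zero + d + sum m (g ∘ suc) ≡⟨ +-assoc (g zero) d _ ⟩
    g zero + (d + sum m (g ∘ suc)) ≡⟨ cong (g zero +_) (+-comm d _) ⟩
    g zero + (sum m (g ∘ suc) + d) ≡⟨ sym (+-assoc (g zero) _ d) ⟩
    g zero + sum m (g ∘ suc) + d ∎
    where open ≡-Reasoning
  sum-extract {ℕ.suc m} {f} {g} {d} (suc c) f≗g f[c]≡ = begin
    f zero + sum m (f ∘ suc)       ≡⟨ cong₂ _+_ (f≗g zero λ ()) rest ⟩
    g zero + (sum m (g ∘ suc) + d) ≡⟨ sym (+-assoc (g zero) _ d) ⟩
    g zero + sum m (g ∘ suc) + d   ∎
    where
    open ≡-Reasoning
    rest : sum m (f ∘ suc) ≡ sum m (g ∘ suc) + d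
    rest = sum-extract c (λ i i≢c → f≗g (suc i) (i≢c ∘ Finₚ.suc-injective)) f[c]≡

  select : Bool → R → R
  select b x = if b then x else 0#

  select-mono : ∀ {b c x} → 0# ≤ x → (Bool.T b → Bool.T c) → select b x ≤ select c x
  select-mono {true}  {true}  _   _   = inj₂ refl
  select-mono {true}  {false} _   b⇒c = ⊥-elim (b⇒c _)
  select-mono {false} {true}  0≤x _   = 0≤x
  select-mono {false} {false} _   _   = inj₂ refl

  select-cong : ∀ {b c x} → (Bool.T b → Bool.T c) → (Bool.T c → Bool.T b) → select b x ≡ select c x
  select-cong {true}  {true}  _   _   = refl
  select-cong {true}  {false} b⇒c _   = ⊥-elim (b⇒c _)
  select-cong {false} {true}  _   c⇒b = ⊥-elim (c⇒b _)
  select-cong {false} {false} _   _   = refl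

  module _ {m : ℕ} (key : Fin m → ℕ) (w : Fin m → R) where

    sumBelow sumUpTo : ℕ → R
    sumBelow k = sum m (λ i → select (key i ℕ.<ᵇ k) (w i))
    sumUpTo  k = sum m (λ i → select (key i ℕ.≤ᵇ k) (w i))

    sumBelow-zero : sumBelow 0 ≡ 0#
    sumBelow-zero = sum-zero {f = λ i → select (key i ℕ.<ᵇ 0) (w i)} (λ _ → refl)

    module _ (w≥0 : ∀ i → 0# ≤ w i) where

      sumBelow-mono : ∀ {k k′} → k ℕ.≤ k′ → sumBelow k ≤ sumBelow k′
      sumBelow-mono k≤k′ = sum-mono λ i → select-mono (w≥0 i) λ i<k →
        ℕₚ.<⇒<ᵇ (ℕₚ.<-≤-trans (ℕₚ.<ᵇ⇒< (key i) _ i<k) k≤k′)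

      sumUpTo≤sumBelow : ∀ {k k′} → k ℕ.< k′ → sumUpTo k ≤ sumBelow k′
      sumUpTo≤sumBelow k<k′ = sum-mono λ i → select-mono (w≥0 i) λ i≤k →
        ℕₚ.<⇒<ᵇ (ℕₚ.≤-<-trans (ℕₚ.≤ᵇ⇒≤ (key i) _ i≤k) k<k′)

    sumUpTo≡sumBelow+w : (∀ {i j} → key i ≡ key j → i ≡ j) →
      ∀ c → sumUpTo (key c) ≡ sumBelow (key c) + w c
    sumUpTo≡sumBelow+w key-injective c = sum-extract c same-off-c at-c
      where
      same-off-c : ∀ i → i ≢ c → select (key i ℕ.≤ᵇ key c) (w i) ≡ select (key i ℕ.<ᵇ key c) (w i)
      same-off-c i i≢c = select-cong
        (λ i≤c → ℕₚ.<⇒<ᵇ (ℕₚ.≤∧≢⇒< (ℕₚ.≤ᵇ⇒≤ (key i) _ i≤c) (i≢c ∘ key-injective)))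
        (λ i<c → ℕₚ.≤⇒≤ᵇ (ℕₚ.<⇒≤ (ℕₚ.<ᵇ⇒< (key i) _ i<c)))
      at-c : select (key c ℕ.≤ᵇ key c) (w c) ≡ select (key c ℕ.<ᵇ key c) (w c) + w c
      at-c = begin
        select (key c ℕ.≤ᵇ key c) (w c)        ≡⟨ select-cong {c = true} _ (λ _ → ℕₚ.≤⇒≤ᵇ (ℕₚ.≤-refl {key c})) ⟩
        w c                                     ≡⟨ sym (+-identityˡ (w c)) ⟩
        0# + w c                                ≡⟨ cong (_+ w c) (select-cong {c = false}
                                                     (λ c<c → ℕₚ.<-irrefl refl (ℕₚ.<ᵇ⇒< (key c) _ c<c)) (λ ())) ⟨
        select (key c ℕ.<ᵇ key c) (w c) + w c  ∎
        where open ≡-Reasoning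

findFin-unique : ∀ {m} (p : Fin m → Bool) c → Bool.T (p c) → (∀ b → Bool.T (p b) → b ≡ c) →
  findFin p ≡ just c
findFin-unique {ℕ.suc m} p c p[c] unique with p zero in p[0]
... | true = cong just (unique zero (subst Bool.T (sym p[0]) _))
findFin-unique {ℕ.suc m} p zero    p[c] unique | false = ⊥-elim (subst Bool.T p[0] p[c])
findFin-unique {ℕ.suc m} p (suc c) p[c] unique | false
  rewrite findFin-unique (p ∘ suc) c p[c] (λ b p[b] → Finₚ.suc-injective (unique (suc b) p[b])) = refl

module Geometry (F : RealField) (n : ℕ) (π : Permutation′ (ℕ.suc n))
                (len : Fin (ℕ.suc n) → RealField.R F) (ℓ : RealField.R F)
                (len-pos : ∀ a → RealField._<_ F (RealField.0# F) (len a)) where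
  open RealOps F
  open OrderedField F
  open IET₁ F n π len ℓ

  len≥0 : ∀ a → 0# ≤ len a
  len≥0 a = inj₁ (len-pos a)

  rank₂-injective : ∀ {a b} → rank₂ a ≡ rank₂ b → a ≡ b
  rank₂-injective {a} {b} eq = begin
    a                     ≡⟨ inverseˡ π ⟨
    π ⟨$⟩ˡ (π ⟨$⟩ʳ a)     ≡⟨ cong (π ⟨$⟩ˡ_) (Finₚ.toℕ-injective eq) ⟩
    π ⟨$⟩ˡ (π ⟨$⟩ʳ b)     ≡⟨ inverseˡ π ⟩
    b                     ∎
    where open ≡-Reasoning

  rank₂[bmin]≡0 : rank₂ bmin ≡ 0
  rank₂[bmin]≡0 = cong toℕ (inverseʳ π)

  rank₂[bmax]≡n : rank₂ bmax ≡ n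
  rank₂[bmax]≡n = trans (cong toℕ (inverseʳ π)) (Finₚ.toℕ-fromℕ n)

  rank₂≤n : ∀ a → rank₂ a ℕ.≤ n
  rank₂≤n a = Finₚ.toℕ≤pred[n] (π ⟨$⟩ʳ a)

  toℕ≤toℕ[aₛ] : ∀ (a : Fin (ℕ.suc n)) → toℕ a ℕ.≤ toℕ aₛ
  toℕ≤toℕ[aₛ] a = subst (toℕ a ℕ.≤_) (sym (Finₚ.toℕ-fromℕ n)) (Finₚ.toℕ≤pred[n] a)

  γ≡ : ∀ a → γ a ≡ ℓ + sumBelow toℕ len (toℕ a)
  γ≡ a = cong (ℓ +_) (sumFin≡sum (ℕ.suc n) (λ b → select (toℕ b ℕ.<ᵇ toℕ a) (len b)))

  μ≡ : ∀ a → μ a ≡ ℓ + sumUpTo toℕ len (toℕ a)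
  μ≡ a = begin
    γ a + len a                                    ≡⟨ cong (_+ len a) (γ≡ a) ⟩
    ℓ + sumBelow toℕ len (toℕ a) + len a           ≡⟨ +-assoc ℓ _ (len a) ⟩
    ℓ + (sumBelow toℕ len (toℕ a) + len a)         ≡⟨ cong (ℓ +_) (sumUpTo≡sumBelow+w toℕ len Finₚ.toℕ-injective a) ⟨
    ℓ + sumUpTo toℕ len (toℕ a)                    ∎
    where open ≡-Reasoning

  ν≡ : ∀ a → ν a ≡ ℓ + sumUpTo rank₂ len (rank₂ a)
  ν≡ a = cong (ℓ +_) (sumFin≡sum (ℕ.suc n) (λ b → select (rank₂ b ℕ.≤ᵇ rank₂ a) (len b)))

  δ≡ : ∀ a → δ a ≡ ℓ + sumBelow rank₂ len (rank₂ a)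
  δ≡ a = begin
    ν a - len a                                          ≡⟨ cong (_- len a) (ν≡ a) ⟩
    ℓ + sumUpTo rank₂ len (rank₂ a) - len a              ≡⟨ cong (λ t → ℓ + t - len a) (sumUpTo≡sumBelow+w rank₂ len rank₂-injective a) ⟩
    ℓ + (sumBelow rank₂ len (rank₂ a) + len a) - len a   ≡⟨ cong (_- len a) (+-assoc ℓ _ (len a)) ⟨
    ℓ + sumBelow rank₂ len (rank₂ a) + len a - len a     ≡⟨ x+y-y≡x _ (len a) ⟩
    ℓ + sumBelow rank₂ len (rank₂ a)                     ∎
    where open ≡-Reasoning

  ν≡δ+len : ∀ a → ν a ≡ δ a + len a
  ν≡δ+len a = sym (x-y+y≡x (ν a) (len a))

  μ≤γ : ∀ {a b} → toℕ b ℕ.< toℕ a → μ b ≤ γ a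
  μ≤γ {a} {b} b<a = subst₂ _≤_ (sym (μ≡ b)) (sym (γ≡ a))
    (+-monoʳ-≤ ℓ (sumUpTo≤sumBelow toℕ len len≥0 b<a))

  ν≤δ : ∀ {a b} → rank₂ b ℕ.< rank₂ a → ν b ≤ δ a
  ν≤δ {a} {b} b<a = subst₂ _≤_ (sym (ν≡ b)) (sym (δ≡ a))
    (+-monoʳ-≤ ℓ (sumUpTo≤sumBelow rank₂ len len≥0 b<a))

  γ≤γ[aₛ] : ∀ a → γ a ≤ γ aₛ
  γ≤γ[aₛ] a = subst₂ _≤_ (sym (γ≡ a)) (sym (γ≡ aₛ))
    (+-monoʳ-≤ ℓ (sumBelow-mono toℕ len len≥0 (toℕ≤toℕ[aₛ] a)))

  δ≤δ[bmax] : ∀ a → δ a ≤ δ bmax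
  δ≤δ[bmax] a = subst₂ _≤_ (sym (δ≡ a)) (sym (δ≡ bmax))
    (+-monoʳ-≤ ℓ (sumBelow-mono rank₂ len len≥0 (subst (rank₂ a ℕ.≤_) (sym rank₂[bmax]≡n) (rank₂≤n a))))

  γ[a₁]≡ℓ : γ a₁ ≡ ℓ
  γ[a₁]≡ℓ = trans (γ≡ a₁) (trans (cong (ℓ +_) (sumBelow-zero toℕ len)) (+-identityʳ ℓ))

  δ[bmin]≡ℓ : δ bmin ≡ ℓ
  δ[bmin]≡ℓ = begin
    δ bmin                                       ≡⟨ δ≡ bmin ⟩
    ℓ + sumBelow rank₂ len (rank₂ bmin)          ≡⟨ cong (λ k → ℓ + sumBelow rank₂ len k) rank₂[bmin]≡0 ⟩
    ℓ + sumBelow rank₂ len 0                     ≡⟨ cong (ℓ +_) (sumBelow-zero rank₂ len) ⟩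
    ℓ + 0#                                       ≡⟨ +-identityʳ ℓ ⟩
    ℓ                                            ∎
    where open ≡-Reasoning

  γ<μ[a₁]⇒≡a₁ : ∀ a → γ a < μ a₁ → a ≡ a₁
  γ<μ[a₁]⇒≡a₁ zero    _    = refl
  γ<μ[a₁]⇒≡a₁ (suc a) γ<μ₁ = ⊥-elim (<-irrefl (<-≤-trans γ<μ₁ (μ≤γ {suc a} {a₁} (s≤s z≤n))))

  δ<ν[bmin]⇒≡bmin : ∀ a → δ a < ν bmin → a ≡ bmin
  δ<ν[bmin]⇒≡bmin a δ<ν₁ with a ≟ bmin
  ... | yes a≡bmin = a≡bmin
  ... | no  a≢bmin = ⊥-elim (<-irrefl (<-≤-trans δ<ν₁ (ν≤δ bmin<a)))
    where
    bmin<a : rank₂ bmin ℕ.< rank₂ a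
    bmin<a = subst (ℕ._< rank₂ a) (sym rank₂[bmin]≡0)
      (ℕₚ.n≢0⇒n>0 (λ a≡0 → a≢bmin (rank₂-injective (trans a≡0 (sym rank₂[bmin]≡0)))))

  T-on-I : ∀ {a x} → x ∈[ γ a , μ a [ → T x ≡ x + ν a - μ a
  T-on-I {a} {x} x∈Iₐ
    rewrite findFin-unique (λ b → (γ b ≤ᵇ x) ∧ (x <ᵇ μ b)) a (∈[,[⇒∈[,[ᵇ x∈Iₐ)
              (λ b x∈I_b → Finₚ.toℕ-injective
                 (ordered-intervals-disjoint toℕ γ μ μ≤γ (∈[,[ᵇ⇒∈[,[ x∈I_b) x∈Iₐ))
    = refl

  T⁻¹-on-J : ∀ {a x} → x ∈[ δ a , ν a [ → T⁻¹ x ≡ x + μ a - ν a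
  T⁻¹-on-J {a} {x} x∈Jₐ
    rewrite findFin-unique (λ b → (δ b ≤ᵇ x) ∧ (x <ᵇ ν b)) a (∈[,[⇒∈[,[ᵇ x∈Jₐ)
              (λ b x∈J_b → rank₂-injective
                 (ordered-intervals-disjoint rank₂ δ ν ν≤δ (∈[,[ᵇ⇒∈[,[ x∈J_b) x∈Jₐ))
    = refl

  T[γ]≡δ : ∀ a → T (γ a) ≡ δ a
  T[γ]≡δ a = begin
    T (γ a)                            ≡⟨ T-on-I (inj₂ refl , x<x+y (γ a) (len-pos a)) ⟩
    γ a + ν a - μ a                    ≡⟨ cong (λ t → γ a + t - μ a) (ν≡δ+len a) ⟩
    γ a + (δ a + len a) - (γ a + len a) ≡⟨ x+[y+z]-[x+z]≡y (γ a) (δ a) (len a) ⟩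
    δ a                                ∎
    where open ≡-Reasoning

  T⁻¹[ℓ]≡γ[bmin] : T⁻¹ ℓ ≡ γ bmin
  T⁻¹[ℓ]≡γ[bmin] = begin
    T⁻¹ ℓ                                       ≡⟨ T⁻¹-on-J (inj₂ δ[bmin]≡ℓ , ℓ<ν[bmin]) ⟩
    ℓ + μ bmin - ν bmin                         ≡⟨ cong (λ t → ℓ + μ bmin - t) ν[bmin]≡ℓ+len ⟩
    ℓ + (γ bmin + len bmin) - (ℓ + len bmin)    ≡⟨ x+[y+z]-[x+z]≡y ℓ (γ bmin) (len bmin) ⟩
    γ bmin                                      ∎
    where
    open ≡-Reasoning
    ν[bmin]≡ℓ+len : ν bmin ≡ ℓ + len bmin
    ν[bmin]≡ℓ+len = trans (ν≡δ+len bmin) (cong (_+ len bmin) δ[bmin]≡ℓ)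
    ℓ<ν[bmin] : ℓ < ν bmin
    ℓ<ν[bmin] = subst (ℓ <_) (sym ν[bmin]≡ℓ+len) (x<x+y ℓ (len-pos bmin))

  IsSeparationPoint : R → Set
  IsSeparationPoint x = ∃ λ a → x ≡ γ a

  module _ {u v : R} (u<μ[a₁] : u < μ a₁) (u<ν[bmin] : u < ν bmin)
           (γ[aₛ]<v : γ aₛ < v) (δ[bmax]<v : δ bmax < v) where

    γ-outside⇒≡ℓ : ∀ a → ¬ InOpen u v (γ a) → γ a ≡ ℓ
    γ-outside⇒≡ℓ a γ∉I = trans (cong γ (γ<μ[a₁]⇒≡a₁ a (≤-<-trans γ≤u u<μ[a₁]))) γ[a₁]≡ℓ
      where
      γ≤u : γ a ≤ u
      γ≤u = ≮⇒≥ λ u<γ → γ∉I (u<γ , ≤-<-trans (γ≤γ[aₛ] a) γ[aₛ]<v)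

    T[γ]-outside⇒≡ℓ : ∀ a → ¬ InOpen u v (T (γ a)) → T (γ a) ≡ ℓ
    T[γ]-outside⇒≡ℓ a Tγ∉I =
      trans (T[γ]≡δ a) (trans (cong δ (δ<ν[bmin]⇒≡bmin a (≤-<-trans δ≤u u<ν[bmin]))) δ[bmin]≡ℓ)
      where
      δ∉I : ¬ InOpen u v (δ a)
      δ∉I = subst (λ x → ¬ InOpen u v x) (T[γ]≡δ a) Tγ∉I
      δ≤u : δ a ≤ u
      δ≤u = ≮⇒≥ λ u<δ → δ∉I (u<δ , ≤-<-trans (δ≤δ[bmax] a) δ[bmax]<v)

    forward-separation : ∀ i k → (∀ m → 1 ℕ.≤ m → m ℕ.≤ k → ¬ InOpen u v (Tⁿ m (γ i))) →
      IsSeparationPoint (Tⁿ k (γ i))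
    forward-separation i ℕ.zero    _       = i , refl
    forward-separation i (ℕ.suc k) outside with forward-separation i k
      (λ m 1≤m m≤k → outside m 1≤m (ℕₚ.m≤n⇒m≤1+n m≤k))
    ... | a , Tᵏγᵢ≡γₐ = a₁ , (begin
      T (Tⁿ k (γ i)) ≡⟨ cong T Tᵏγᵢ≡γₐ ⟩
      T (γ a)        ≡⟨ T[γ]-outside⇒≡ℓ a Tγₐ∉I ⟩
      ℓ              ≡⟨ γ[a₁]≡ℓ ⟨
      γ a₁           ∎)
      where
      open ≡-Reasoning
      Tγₐ∉I : ¬ InOpen u v (T (γ a))
      Tγₐ∉I = subst (λ x → ¬ InOpen u v (T x)) Tᵏγᵢ≡γₐ (outside (ℕ.suc k) (s≤s z≤n) ℕₚ.≤-refl)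

    backward-separation : ∀ i k → (∀ m → m ℕ.< k → ¬ InOpen u v (T⁻ⁿ m (γ i))) →
      IsSeparationPoint (T⁻ⁿ k (γ i))
    backward-separation i ℕ.zero    _       = i , refl
    backward-separation i (ℕ.suc k) outside with backward-separation i k
      (λ m m<k → outside m (ℕₚ.m<n⇒m<1+n m<k))
    ... | a , T⁻ᵏγᵢ≡γₐ = bmin , (begin
      T⁻¹ (T⁻ⁿ k (γ i)) ≡⟨ cong T⁻¹ T⁻ᵏγᵢ≡γₐ ⟩
      T⁻¹ (γ a)         ≡⟨ cong T⁻¹ (γ-outside⇒≡ℓ a γₐ∉I) ⟩
      T⁻¹ ℓ             ≡⟨ T⁻¹[ℓ]≡γ[bmin] ⟩
      γ bmin            ∎)
      where
      open ≡-Reasoning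
      γₐ∉I : ¬ InOpen u v (γ a)
      γₐ∉I = subst (λ x → ¬ InOpen u v x) T⁻ᵏγᵢ≡γₐ (outside k ℕₚ.≤-refl)

    Div⇒separation : ∀ {x} → Div u v x → IsSeparationPoint x
    Div⇒separation (i , inj₁ (k , x≡ , outside)) =
      subst IsSeparationPoint (sym x≡) (forward-separation i k outside)
    Div⇒separation (i , inj₂ (k , _ , x≡ , outside)) =
      subst IsSeparationPoint (sym x≡) (backward-separation i k outside)

    admissible⇒whole : Admissible u v → u ≡ ℓ × v ≡ r
    admissible⇒whole (_ , u<v , v≤r , u-end , v-end) = u≡ℓ u-end , v≡r v-end
      where
      u≡ℓ : Div u v u ⊎ u ≡ r → u ≡ ℓ
      u≡ℓ (inj₁ u∈Div) with Div⇒separation u∈Div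
      ... | a , u≡γₐ = trans u≡γₐ (γ-outside⇒≡ℓ a λ (u<γₐ , _) → <-irrefl (subst (u <_) (sym u≡γₐ) u<γₐ))
      u≡ℓ (inj₂ u≡r) = ⊥-elim (<-irrefl (subst (_< r) u≡r (<-≤-trans u<v v≤r)))
      v≡r : Div u v v ⊎ v ≡ r → v ≡ r
      v≡r (inj₁ v∈Div) with Div⇒separation v∈Div
      ... | a , v≡γₐ = ⊥-elim (<-irrefl (subst (_< v) (sym v≡γₐ) (≤-<-trans (γ≤γ[aₛ] a) γ[aₛ]<v)))
      v≡r (inj₂ v≡r) = v≡r

  ⊆-interval : ∀ {u v a b} → a ≤ u → v ≤ b → SubInterval u v a b
  ⊆-interval a≤u v≤b z u≤z z<v = ≤-trans a≤u u≤z , <-≤-trans z<v v≤b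

lemma4p4 : (F : RealField) (n : ℕ) (π : Permutation′ (ℕ.suc n))
    (len : Fin (ℕ.suc n) → RealField.R F) (ℓ : RealField.R F) →
    (∀ a → RealField._<_ F (RealField.0# F) (len a)) →
    IET₁.Regular F n π len ℓ →
    (u v : RealField.R F) →
    IET₁.Admissible F n π len ℓ u v →
    ¬ ((u ≡ ℓ) × (v ≡ IET₁.r F n π len ℓ)) →
    IET₁.SubInterval F n π len ℓ u v (IET₁.Yleft F n π len ℓ) (IET₁.r F n π len ℓ)
    ⊎ IET₁.SubInterval F n π len ℓ u v ℓ (IET₁.Zright F n π len ℓ)
lemma4p4 F n π len ℓ len-pos _ u v = admissible⇒⊆Y⊎⊆Z
  where
  open RealOps F
  open OrderedField F
  open IET₁ F n π len ℓ
  open Geometry F n π len ℓ len-pos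

  admissible⇒⊆Y⊎⊆Z : Admissible u v → ¬ (u ≡ ℓ × v ≡ r) →
    SubInterval u v Yleft r ⊎ SubInterval u v ℓ Zright
  admissible⇒⊆Y⊎⊆Z adm@(ℓ≤u , _ , v≤r , _) not-whole with u <? Yleft | Zright <? v
  ... | no u≮Y  | _       = inj₁ (⊆-interval (≮⇒≥ u≮Y) v≤r)
  ... | yes _   | no Z≮v  = inj₂ (⊆-interval ℓ≤u (≮⇒≥ Z≮v))
  ... | yes u<Y | yes Z<v = ⊥-elim (not-whole (admissible⇒whole
        (<-≤-trans u<Y (min≤ˡ _ _)) (<-≤-trans u<Y (min≤ʳ _ _))
        (≤-<-trans (≤maxˡ _ _) Z<v) (≤-<-trans (≤maxʳ _ _) Z<v) adm))
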